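{- Let $L\ge1$, $J\ge0$, $m\ge0$ be integers and $Q_{\ell,j}(x)$ ($0\le\ell\le L$, $0\le j\le J$) polynomials with nonnegative coefficients; set $Q_\ell(x,u)=\sum_{j=0}^JQ_{\ell,j}(x)u^j$. Let $G_m(x,u)=\sum_{k\ge0}G_{m;k}(x)u^k$ be the power series solution of \[ G_m(x,u)=u^m+x\sum_{\ell=0}^LQ_\ell(x,u)\,\Delta^\ell G_m(x,u). \] Then for all $k\ge0$, $G_{m;k}(x)=F^{[\ge0]}_{k,m}(x)$, i.e. $G_{m;k}(x)$ is the generating function of the allowed lattice paths that start at level $k$ and end at level $m$.
   Context: For $G(x,u)=\sum_kG_k(x)u^k$ and $\ell\ge1$, $\Delta^\ell G(x,u)=\sum_{k\ge0}G_{k+\ell}(x)u^k$; $\Delta^0G=G$. Steps and paths: for each level $h\ge0$, the multiset $\mathcal S_h$ contains, for each triple $(\ell,j,r)$ with $0\le\ell\le L$, $0\le j\le\min(h,J)$, $r\ge0$, $[x^r]Q_{\ell,j}(x)\ne0$, one copy of the step $(1+r,\ell-j)$ with weight $[x^r]Q_{\ell,j}(x)$ (distinct triples, distinct copies). An allowed path from level $a$ to level $b$ of length $n$ is a sequence $s_1\cdots s_M$ ($M\ge0$) with heights $h_0=a$, $h_m$ after $m$ steps, $s_m\in\mathcal S_{h_{m-1}}$, $h_M=b$, horizontal components summing to $n$; its weight is the product of step weights (the empty path from $a$ to $a$ has weight 1 and length 0). $F^{[\ge0]}_{k,m}(x)=\sum_pw(p)x^{\mathrm{length}(p)}$ over all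 allowed paths from level $k$ to level $m$ (heights are automatically $\ge0$). -}

module Defs where

open import Level using (Level)
open import Algebra.Bundles using (CommutativeSemiring)
open import Data.Nat using (ℕ; zero; suc; _+_; _∸_; _≤ᵇ_; _≡ᵇ_)
open import Data.Bool using (Bool; true; false; _∧_; if_then_else_)
open import Data.Product using (_×_; _,_)
open import Data.List using (List; []; _∷_; map; concatMap; upTo; foldr)

-- Everything is parametrised by the coefficient semiring R
-- (the paper's coefficients are nonnegative reals, a commutative semiring).
module _ {c ℓr : Level} (R : CommutativeSemiring c ℓr) where
  open CommutativeSemiring R using (Carrier; 0#; 1#) renaming (_+_ to _+R_; _*_ to _*R_)

  Σ≤ : ℕ → (ℕ → Carrier) → Carrier
  Σ≤ zero    f = f 0
  Σ≤ (suc N) f = Σ≤ N f +R f (suc N)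

  -- Bivariate formal power series in (x,u):  A k n = [u^k x^n] A
  Ser2 : Set c
  Ser2 = ℕ → ℕ → Carrier

  _⊕_ : Ser2 → Ser2 → Ser2
  (A ⊕ B) k n = A k n +R B k n

  _⊛_ : Ser2 → Ser2 → Ser2
  (A ⊛ B) k n = Σ≤ k (λ i → Σ≤ n (λ p → A i p *R B (k ∸ i) (n ∸ p)))

  xS : Ser2 → Ser2
  xS A k zero    = 0#
  xS A k (suc n) = A k n

  uPow : ℕ → Ser2
  uPow m k n = if (k ≡ᵇ m) ∧ (n ≡ᵇ 0) then 1# else 0#

  Δ : ℕ → Ser2 → Ser2
  Δ ℓ A k n = A (k + ℓ) n

  ΣSer : ℕ → (ℕ → Ser2) → Ser2
  ΣSer L A k n = Σ≤ L (λ ℓ → A ℓ k n)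

  -- The data: Q ℓ j r = [x^r] Q_{ℓ,j}(x)  (only 0 ≤ ℓ ≤ L, 0 ≤ j ≤ J used)

  QSer : (J : ℕ) → (ℕ → ℕ → ℕ → Carrier) → ℕ → Ser2
  QSer J Q ℓ k n = if k ≤ᵇ J then Q ℓ k n else 0#

  RHS : (L J m : ℕ) → (ℕ → ℕ → ℕ → Carrier) → Ser2 → Ser2
  RHS L J m Q G = uPow m ⊕ xS (ΣSer L (λ ℓ → QSer J Q ℓ ⊛ Δ ℓ G))

  -- Lattice paths.  A step is the triple (ℓ , j , r): the step (1+r, ℓ-j)
  -- coming from the monomial [x^r] Q_{ℓ,j}, weight Q ℓ j r.
  Triple : Set
  Triple = ℕ × ℕ × ℕ

  -- all triples with ℓ ≤ L, j ≤ J, r ≤ d  (d a degree bound for all Q_{ℓ,j})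
  alphabet : (L J d : ℕ) → List Triple
  alphabet L J d =
    concatMap (λ ℓ → concatMap (λ j → map (λ r → (ℓ , j , r)) (upTo (suc d)))
                                (upTo (suc J)))
              (upTo (suc L))

  words : (L J d : ℕ) → ℕ → List (List Triple)
  words L J d zero    = [] ∷ []
  words L J d (suc M) = concatMap (λ t → map (t ∷_) (words L J d M)) (alphabet L J d)

  wordsUpTo : (L J d : ℕ) → ℕ → List (List Triple)
  wordsUpTo L J d N = concatMap (words L J d) (upTo (suc N))

  -- every step is legal at the height where it is taken (j ≤ min(h,J);
  -- j ≤ J and ℓ ≤ L are guaranteed by the alphabet)
  legal : ℕ → List Triple → Bool
  legal h []                  = true
  legal h ((ℓ , j , r) ∷ s) = (j ≤ᵇ h) ∧ legal (h + ℓ ∸ j) s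

  endLevel : ℕ → List Triple → ℕ
  endLevel h []                  = h
  endLevel h ((ℓ , j , r) ∷ s) = endLevel (h + ℓ ∸ j) s

  pathLength : List Triple → ℕ
  pathLength []                  = 0
  pathLength ((ℓ , j , r) ∷ s) = suc r + pathLength s

  weight : (ℕ → ℕ → ℕ → Carrier) → List Triple → Carrier
  weight Q []                  = 1#
  weight Q ((ℓ , j , r) ∷ s) = Q ℓ j r *R weight Q s

  isPath : ℕ → ℕ → ℕ → List Triple → Bool
  isPath a b n s = legal a s ∧ (endLevel a s ≡ᵇ b) ∧ (pathLength s ≡ᵇ n)

  -- [x^n] F^{[≥0]}_{a,b}(x): sum of weights of allowed paths a → b of length n.
  -- (Every step has horizontal length ≥ 1, so such paths have ≤ n steps.)
  Fcoef : (L J d : ℕ) → (ℕ → ℕ → ℕ → Carrier) → (a b n : ℕ) → Carrier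
  Fcoef L J d Q a b n =
    foldr (λ s acc → (if isPath a b n s then weight Q s else 0#) +R acc) 0#
          (wordsUpTo L J d n)

{-# OPTIONS --safe #-}
-- Splitting off the first step of a path gives a first-step decomposition of the path
-- generating functions: a step (ℓ , j , r) taken at level k costs x^(1+r) and leads to
-- level k + ℓ − j, which is exactly the term [u^k] x Q_{ℓ,j}(x) u^j Δ^ℓ G of the equation.
-- So the path coefficients F_{k,m} solve the same equation as G.  Because of the factor x,
-- the coefficient of x^n on the right only involves coefficients of x^n' with n' < n, so the
-- equation has at most one solution and G = F by strong induction on n.
module Submission where

open import Defs
open import Level using (Level; _⊔_)
open import Algebra.Bundles using (CommutativeSemiring; CommutativeMonoid)
import Algebra.Properties.CommutativeSemigroup as CommSemigroupProperties
open import Data.Nat using (ℕ; zero; suc; _+_; _∸_; _≤_; _<_; _≤ᵇ_; _≡ᵇ_; z≤n; s≤s)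
open import Data.Nat.Properties
  using (_≤?_; ≤-refl; <⇒≱; ≤-<-trans; m≤n⇒m≤1+n; m≤n⇒m<n∨m≡n; m∸n≤m; m≤m+n; m≤n+m; +-∸-comm)
open import Data.Nat.Induction using (<-rec)
open import Data.Bool using (true; false; _∧_; if_then_else_)
open import Data.Bool.Properties using (∧-zeroʳ)
open import Data.Product using (_,_)
open import Data.Sum using (_⊎_; inj₁; inj₂)
open import Data.List using (List; []; _∷_; _++_; map; concatMap; applyUpTo; upTo; foldr)
open import Relation.Nullary.Decidable using (dec-true; dec-false)
open import Relation.Binary.PropositionalEquality as ≡ using (_≡_)
import Relation.Binary.Reasoning.Setoid as SetoidReasoning

≤ᵇ-true : ∀ {m n} → m ≤ n → (m ≤ᵇ n) ≡ true
≤ᵇ-true {m} {n} = dec-true (m ≤? n)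

≤ᵇ-false : ∀ {m n} → n < m → (m ≤ᵇ n) ≡ false
≤ᵇ-false {m} {n} n<m = dec-false (m ≤? n) (<⇒≱ n<m)

+-≡ᵇ-split : ∀ r x n → (r + x ≡ᵇ n) ≡ (r ≤ᵇ n) ∧ (x ≡ᵇ n ∸ r)
+-≡ᵇ-split zero          x n       = ≡.refl
+-≡ᵇ-split (suc r)       x zero    = ≡.refl
+-≡ᵇ-split (suc zero)    x (suc n) = ≡.refl
+-≡ᵇ-split (suc (suc r)) x (suc n) = +-≡ᵇ-split (suc r) x n

∧-pull-guards : ∀ c l e x y → (c ∧ l) ∧ (e ∧ (x ∧ y)) ≡ (c ∧ x) ∧ (l ∧ (e ∧ y))
∧-pull-guards false l e x     y = ≡.refl
∧-pull-guards true  l e true  y = ≡.refl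
∧-pull-guards true  l e false y = ≡.trans (≡.cong (l ∧_) (∧-zeroʳ e)) (∧-zeroʳ l)

module _ {c ℓr : Level} (R : CommutativeSemiring c ℓr) where
  open CommutativeSemiring R renaming (_+_ to _+R_; _*_ to _*R_)
  open SetoidReasoning setoid
  open CommSemigroupProperties
    (CommutativeMonoid.commutativeSemigroup +-commutativeMonoid) using (interchange)

  Σ : ℕ → (ℕ → Carrier) → Carrier
  Σ = Σ≤ R

  Σ-cong : ∀ N {f g} → (∀ i → f i ≈ g i) → Σ N f ≈ Σ N g
  Σ-cong zero    f≈g = f≈g 0
  Σ-cong (suc N) f≈g = +-cong (Σ-cong N f≈g) (f≈g (suc N))

  Σ-cong-≤ : ∀ N {f g} → (∀ i → i ≤ N → f i ≈ g i) → Σ N f ≈ Σ N g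
  Σ-cong-≤ zero    f≈g = f≈g 0 z≤n
  Σ-cong-≤ (suc N) f≈g =
    +-cong (Σ-cong-≤ N (λ i i≤N → f≈g i (m≤n⇒m≤1+n i≤N))) (f≈g (suc N) ≤-refl)

  Σ-zero : ∀ N {f} → (∀ i → f i ≈ 0#) → Σ N f ≈ 0#
  Σ-zero N f≈0 = trans (Σ-cong N f≈0) (zeros N)
    where
    zeros : ∀ N → Σ N (λ _ → 0#) ≈ 0#
    zeros zero    = refl
    zeros (suc N) = trans (+-cong (zeros N) refl) (+-identityˡ 0#)

  Σ-+ : ∀ N {f g} → Σ N (λ i → f i +R g i) ≈ Σ N f +R Σ N g
  Σ-+ zero    = refl
  Σ-+ (suc N) = trans (+-cong (Σ-+ N) refl) (interchange _ _ _ _)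

  Σ-comm : ∀ N K {f : ℕ → ℕ → Carrier} → Σ N (λ i → Σ K (f i)) ≈ Σ K (λ j → Σ N (λ i → f i j))
  Σ-comm zero    K = refl
  Σ-comm (suc N) K = trans (+-cong (Σ-comm N K) refl) (sym (Σ-+ K))

  Σ-*ˡ : ∀ N x {f} → x *R Σ N f ≈ Σ N (λ i → x *R f i)
  Σ-*ˡ zero    x = refl
  Σ-*ˡ (suc N) x = trans (distribˡ x _ _) (+-cong (Σ-*ˡ N x) refl)

  Σ-suc : ∀ N {f} → Σ (suc N) f ≈ f 0 +R Σ N (λ i → f (suc i))
  Σ-suc zero    = refl
  Σ-suc (suc N) = trans (+-cong (Σ-suc N) refl) (+-assoc _ _ _)

  Σ-extend : ∀ {N} N' {f} → N ≤ N' → (∀ i → N < i → f i ≈ 0#) → Σ N f ≈ Σ N' f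
  Σ-extend zero      z≤n _ = refl
  Σ-extend {N} (suc N') {f} N≤1+N' f≈0 with m≤n⇒m<n∨m≡n N≤1+N'
  ... | inj₂ ≡.refl = refl
  ... | inj₁ (s≤s N≤N') = begin
    Σ N f                   ≈⟨ Σ-extend N' N≤N' f≈0 ⟩
    Σ N' f                  ≈⟨ +-identityʳ _ ⟨
    Σ N' f +R 0#            ≈⟨ +-cong refl (f≈0 (suc N') (s≤s N≤N')) ⟨
    Σ N' f +R f (suc N')    ∎

  Σ²-extend : ∀ {A B} A' B' {f g : ℕ → ℕ → Carrier} → A ≤ A' → B ≤ B' →
              (∀ i p → i ≤ A → p ≤ B → f i p ≈ g i p) →
              (∀ i p → A < i ⊎ B < p → g i p ≈ 0#) →
              Σ A (λ i → Σ B (f i)) ≈ Σ A' (λ i → Σ B' (g i))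
  Σ²-extend {A} {B} A' B' {f} {g} A≤A' B≤B' f≈g g≈0 = begin
    Σ A (λ i → Σ B (f i))   ≈⟨ Σ-cong-≤ A (λ i i≤A → Σ-cong-≤ B (λ p p≤B → f≈g i p i≤A p≤B)) ⟩
    Σ A (λ i → Σ B (g i))   ≈⟨ Σ-cong A (λ i → Σ-extend B' B≤B' (λ p B<p → g≈0 i p (inj₂ B<p))) ⟩
    Σ A (λ i → Σ B' (g i))  ≈⟨ Σ-extend A' A≤A' (λ i A<i → Σ-zero B' (λ p → g≈0 i p (inj₁ A<i))) ⟩
    Σ A' (λ i → Σ B' (g i)) ∎

  listSum : {A : Set} → List A → (A → Carrier) → Carrier
  listSum xs f = foldr (λ x acc → f x +R acc) 0# xs

  listSum-cong : ∀ {A : Set} (xs : List A) {f g} → (∀ x → f x ≈ g x) → listSum xs f ≈ listSum xs g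
  listSum-cong []       f≈g = refl
  listSum-cong (x ∷ xs) f≈g = +-cong (f≈g x) (listSum-cong xs f≈g)

  listSum-zero : ∀ {A : Set} (xs : List A) {f} → (∀ x → f x ≈ 0#) → listSum xs f ≈ 0#
  listSum-zero []       f≈0 = refl
  listSum-zero (x ∷ xs) f≈0 = trans (+-cong (f≈0 x) (listSum-zero xs f≈0)) (+-identityˡ 0#)

  listSum-*ˡ : ∀ {A : Set} (xs : List A) y f → y *R listSum xs f ≈ listSum xs (λ x → y *R f x)
  listSum-*ˡ []       y f = zeroʳ y
  listSum-*ˡ (x ∷ xs) y f = trans (distribˡ y _ _) (+-cong refl (listSum-*ˡ xs y f))

  listSum-++ : ∀ {A : Set} (xs ys : List A) f → listSum (xs ++ ys) f ≈ listSum xs f +R listSum ys f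
  listSum-++ []       ys f = sym (+-identityˡ _)
  listSum-++ (x ∷ xs) ys f = trans (+-cong refl (listSum-++ xs ys f)) (sym (+-assoc _ _ _))

  listSum-concatMap : ∀ {A B : Set} (h : A → List B) xs f →
                      listSum (concatMap h xs) f ≈ listSum xs (λ x → listSum (h x) f)
  listSum-concatMap h []       f = refl
  listSum-concatMap h (x ∷ xs) f = trans (listSum-++ (h x) _ f) (+-cong refl (listSum-concatMap h xs f))

  listSum-map : ∀ {A B : Set} (h : A → B) xs f → listSum (map h xs) f ≈ listSum xs (λ x → f (h x))
  listSum-map h []       f = refl
  listSum-map h (x ∷ xs) f = +-cong refl (listSum-map h xs f)

  listSum-applyUpTo : ∀ {A : Set} N (g : ℕ → A) f → listSum (applyUpTo g (suc N)) f ≈ Σ N (λ i → f (g i))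
  listSum-applyUpTo zero    g f = +-identityʳ _
  listSum-applyUpTo (suc N) g f =
    trans (+-cong refl (listSum-applyUpTo N (λ i → g (suc i)) f)) (sym (Σ-suc N))

  listSum-upTo : ∀ N f → listSum (upTo (suc N)) f ≈ Σ N f
  listSum-upTo N f = listSum-applyUpTo N (λ i → i) f

  listSum-concatMap-upTo : ∀ {B : Set} (h : ℕ → List B) N f →
                           listSum (concatMap h (upTo (suc N))) f ≈ Σ N (λ i → listSum (h i) f)
  listSum-concatMap-upTo h N f = trans (listSum-concatMap h (upTo (suc N)) f) (listSum-upTo N _)

  if-cong : ∀ b {x y} → x ≈ y → (if b then x else 0#) ≈ (if b then y else 0#)
  if-cong false x≈y = refl
  if-cong true  x≈y = x≈y

  if-zero : ∀ b {x} → x ≈ 0# → (if b then x else 0#) ≈ 0#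
  if-zero b x≈0 = trans (if-cong b x≈0) (reflexive (ifSame b))
    where
    ifSame : ∀ b → (if b then 0# else 0#) ≡ 0#
    ifSame false = ≡.refl
    ifSame true  = ≡.refl

  if-∧-* : ∀ b b' x y → (if b ∧ b' then x *R y else 0#) ≈ (if b then x else 0#) *R (if b' then y else 0#)
  if-∧-* false b'    x y = sym (zeroˡ _)
  if-∧-* true  false x y = sym (zeroʳ x)
  if-∧-* true  true  x y = refl

  Contractive : (Ser2 R → Ser2 R) → Set (c ⊔ ℓr)
  Contractive Φ = ∀ G H n → (∀ k n' → n' < n → G k n' ≈ H k n') → ∀ k → Φ G k n ≈ Φ H k n

  fixpoint-unique : ∀ {Φ} → Contractive Φ → ∀ {G H} →
                    (∀ k n → G k n ≈ Φ G k n) → (∀ k n → H k n ≈ Φ H k n) →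
                    ∀ k n → G k n ≈ H k n
  fixpoint-unique {Φ} contractive {G} {H} G≈ΦG H≈ΦH k n =
    <-rec (λ n → ∀ k → G k n ≈ H k n) step n k
    where
    step : ∀ n → (∀ {n'} → n' < n → ∀ k → G k n' ≈ H k n') → ∀ k → G k n ≈ H k n
    step n ih k = begin
      G k n    ≈⟨ G≈ΦG k n ⟩
      Φ G k n  ≈⟨ contractive G H n (λ k' n' n'<n → ih n'<n k') k ⟩
      Φ H k n  ≈⟨ H≈ΦH k n ⟨
      H k n    ∎

  RHS-contractive : ∀ L J m Q → Contractive (RHS R L J m Q)
  RHS-contractive L J m Q G H zero    agree k = refl
  RHS-contractive L J m Q G H (suc n) agree k =
    +-cong refl (Σ-cong L (λ ℓ → Σ-cong k (λ i → Σ-cong n (λ p →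
      *-cong refl (agree _ (n ∸ p) (s≤s (m∸n≤m n p)))))))

  module _ (L J m d : ℕ) (Q : ℕ → ℕ → ℕ → Carrier) where

    ΣSteps : (ℕ → ℕ → ℕ → Carrier) → Carrier
    ΣSteps f = Σ L (λ ℓ → Σ J (λ j → Σ d (λ r → f ℓ j r)))

    ΣSteps-cong : ∀ {f g} → (∀ ℓ j r → f ℓ j r ≈ g ℓ j r) → ΣSteps f ≈ ΣSteps g
    ΣSteps-cong f≈g = Σ-cong L (λ ℓ → Σ-cong J (λ j → Σ-cong d (f≈g ℓ j)))

    ΣSteps-zero : ∀ {f} → (∀ ℓ j r → f ℓ j r ≈ 0#) → ΣSteps f ≈ 0#
    ΣSteps-zero f≈0 = Σ-zero L (λ ℓ → Σ-zero J (λ j → Σ-zero d (f≈0 ℓ j)))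

    Σ-ΣSteps-comm : ∀ N {f : ℕ → ℕ → ℕ → ℕ → Carrier} →
                    Σ N (λ M → ΣSteps (f M)) ≈ ΣSteps (λ ℓ j r → Σ N (λ M → f M ℓ j r))
    Σ-ΣSteps-comm N = trans (Σ-comm N L) (Σ-cong L (λ ℓ →
                      trans (Σ-comm N J) (Σ-cong J (λ j → Σ-comm N d))))

    -- Weight of (ℓ , j , r) as the first step of a path from level a of total length suc n.
    stepWeight : (ℕ → ℕ → ℕ → Carrier) → (a n ℓ j r : ℕ) → Carrier
    stepWeight q a n ℓ j r = if (j ≤ᵇ a) ∧ (r ≤ᵇ n) then q ℓ j r else 0#

    stepWeight-inside : ∀ q {a n} ℓ {j r} → j ≤ a → r ≤ n → stepWeight q a n ℓ j r ≡ q ℓ j r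
    stepWeight-inside q ℓ j≤a r≤n rewrite ≤ᵇ-true j≤a | ≤ᵇ-true r≤n = ≡.refl

    stepWeight-outside : ∀ q {a n} ℓ {j r} → a < j ⊎ n < r → stepWeight q a n ℓ j r ≡ 0#
    stepWeight-outside q ℓ (inj₁ a<j) rewrite ≤ᵇ-false a<j = ≡.refl
    stepWeight-outside q {a} ℓ {j} (inj₂ n<r) rewrite ≤ᵇ-false n<r | ∧-zeroʳ (j ≤ᵇ a) = ≡.refl

    listSum-alphabet : ∀ F → listSum (alphabet R L J d) F ≈ ΣSteps (λ ℓ j r → F (ℓ , j , r))
    listSum-alphabet F =
      trans (listSum-concatMap-upTo alphabetAt L F) (Σ-cong L (λ ℓ →
      trans (listSum-concatMap-upTo (alphabetAt₂ ℓ) J F) (Σ-cong J (λ j →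
      trans (listSum-map (λ r → (ℓ , j , r)) (upTo (suc d)) F) (listSum-upTo d _)))))
      where
      alphabetAt₂ : ℕ → ℕ → List (Triple R)
      alphabetAt₂ ℓ j = map (λ r → (ℓ , j , r)) (upTo (suc d))
      alphabetAt : ℕ → List (Triple R)
      alphabetAt ℓ = concatMap (alphabetAt₂ ℓ) (upTo (suc J))

    listSum-words-suc : ∀ M f → listSum (words R L J d (suc M)) f ≈
                                ΣSteps (λ ℓ j r → listSum (words R L J d M) (λ s → f ((ℓ , j , r) ∷ s)))
    listSum-words-suc M f =
      trans (listSum-concatMap (λ t → map (t ∷_) (words R L J d M)) (alphabet R L J d) f)
            (trans (listSum-cong (alphabet R L J d) (λ t → listSum-map (t ∷_) (words R L J d M) f))
                   (listSum-alphabet _))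

    isPath-nonempty-length-zero : ∀ a b t s → isPath R a b 0 (t ∷ s) ≡ false
    isPath-nonempty-length-zero a b (ℓ , j , r) s =
      ≡.trans (≡.cong (legal R a ((ℓ , j , r) ∷ s) ∧_) (∧-zeroʳ _)) (∧-zeroʳ _)

    isPath-step : ∀ a b n ℓ j r s →
                  isPath R a b (suc n) ((ℓ , j , r) ∷ s) ≡
                  ((j ≤ᵇ a) ∧ (r ≤ᵇ n)) ∧ isPath R (a + ℓ ∸ j) b (n ∸ r) s
    isPath-step a b n ℓ j r s =
      ≡.trans (≡.cong (λ z → ((j ≤ᵇ a) ∧ legal R a' s) ∧ ((endLevel R a' s ≡ᵇ b) ∧ z))
                      (+-≡ᵇ-split r (pathLength R s) n))
              (∧-pull-guards (j ≤ᵇ a) (legal R a' s) (endLevel R a' s ≡ᵇ b) (r ≤ᵇ n) _)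
      where
      a' = a + ℓ ∸ j

    weightIfPath : ℕ → ℕ → List (Triple R) → Carrier
    weightIfPath a n s = if isPath R a m n s then weight R Q s else 0#

    weightIfPath-step : ∀ a n ℓ j r s →
                        weightIfPath a (suc n) ((ℓ , j , r) ∷ s) ≈
                        stepWeight Q a n ℓ j r *R weightIfPath (a + ℓ ∸ j) (n ∸ r) s
    weightIfPath-step a n ℓ j r s =
      trans (reflexive (≡.cong (λ b → if b then Q ℓ j r *R weight R Q s else 0#) (isPath-step a m n ℓ j r s)))
            (if-∧-* ((j ≤ᵇ a) ∧ (r ≤ᵇ n)) (isPath R (a + ℓ ∸ j) m (n ∸ r) s) _ _)

    Fsteps : ℕ → ℕ → ℕ → Carrier
    Fsteps M a n = listSum (words R L J d M) (weightIfPath a n)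

    Fsteps-zero : ∀ a n → Fsteps 0 a n ≈ uPow R m a n
    Fsteps-zero a zero    = +-identityʳ _
    Fsteps-zero a (suc n) = +-identityʳ _

    Fsteps-suc-zero : ∀ M a → Fsteps (suc M) a 0 ≈ 0#
    Fsteps-suc-zero M a =
      trans (listSum-words-suc M (weightIfPath a 0)) (ΣSteps-zero (λ ℓ j r →
        listSum-zero (words R L J d M) (λ s →
          reflexive (≡.cong (λ b → if b then _ else 0#) (isPath-nonempty-length-zero a m (ℓ , j , r) s)))))

    Fsteps-suc-suc : ∀ M a n → Fsteps (suc M) a (suc n) ≈
                     ΣSteps (λ ℓ j r → stepWeight Q a n ℓ j r *R Fsteps M (a + ℓ ∸ j) (n ∸ r))
    Fsteps-suc-suc M a n =
      trans (listSum-words-suc M (weightIfPath a (suc n))) (ΣSteps-cong (λ ℓ j r →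
        trans (listSum-cong (words R L J d M) (weightIfPath-step a n ℓ j r))
              (sym (listSum-*ˡ (words R L J d M) _ _))))

    Fsteps-vanish : ∀ M a n → n < M → Fsteps M a n ≈ 0#
    Fsteps-vanish (suc M) a zero    _           = Fsteps-suc-zero M a
    Fsteps-vanish (suc M) a (suc n) (s≤s n<M) =
      trans (Fsteps-suc-suc M a n) (ΣSteps-zero (λ ℓ j r →
        trans (*-cong refl (Fsteps-vanish M _ (n ∸ r) (≤-<-trans (m∸n≤m n r) n<M))) (zeroʳ _)))

    F : Ser2 R
    F a n = Fcoef R L J d Q a m n

    F-by-steps : ∀ {n} N a → n ≤ N → F a n ≈ Σ N (λ M → Fsteps M a n)
    F-by-steps {n} N a n≤N =
      trans (listSum-concatMap-upTo (words R L J d) n (weightIfPath a n))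
            (Σ-extend N n≤N (λ M n<M → Fsteps-vanish M a n n<M))

    convolution-as-steps : (∀ ℓ j r → d < r → Q ℓ j r ≈ 0#) → ∀ (H : Ser2 R) a n →
      Σ L (λ ℓ → Σ a (λ i → Σ n (λ p → QSer R J Q ℓ i p *R H (a ∸ i + ℓ) (n ∸ p)))) ≈
      ΣSteps (λ ℓ j r → stepWeight Q a n ℓ j r *R H (a + ℓ ∸ j) (n ∸ r))
    convolution-as-steps Q≈0 H a n = Σ-cong L (λ ℓ →
      trans (Σ²-extend (a + J) (n + d) (m≤m+n a J) (m≤m+n n d) (conv-inside ℓ) (conv-outside ℓ))
            (sym (Σ²-extend (a + J) (n + d) (m≤n+m J a) (m≤n+m d n) (steps-inside ℓ) (steps-outside ℓ))))
      where
      common : ℕ → ℕ → ℕ → Carrier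
      common ℓ j r = stepWeight (QSer R J Q) a n ℓ j r *R H (a + ℓ ∸ j) (n ∸ r)

      conv-inside : ∀ ℓ i p → i ≤ a → p ≤ n →
                    QSer R J Q ℓ i p *R H (a ∸ i + ℓ) (n ∸ p) ≈ common ℓ i p
      conv-inside ℓ i p i≤a p≤n =
        *-cong (reflexive (≡.sym (stepWeight-inside (QSer R J Q) ℓ i≤a p≤n)))
               (reflexive (≡.cong (λ h → H h (n ∸ p)) (≡.sym (+-∸-comm ℓ i≤a))))

      conv-outside : ∀ ℓ i p → a < i ⊎ n < p → common ℓ i p ≈ 0#
      conv-outside ℓ i p out =
        trans (*-cong (reflexive (stepWeight-outside (QSer R J Q) ℓ out)) refl) (zeroˡ _)

      steps-inside : ∀ ℓ j r → j ≤ J → r ≤ d →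
                     stepWeight Q a n ℓ j r *R H (a + ℓ ∸ j) (n ∸ r) ≈ common ℓ j r
      steps-inside ℓ j r j≤J _ =
        *-cong (if-cong ((j ≤ᵇ a) ∧ (r ≤ᵇ n))
                        (reflexive (≡.cong (λ b → if b then Q ℓ j r else 0#) (≡.sym (≤ᵇ-true j≤J)))))
               refl

      QSer-outside : ∀ ℓ j r → J < j ⊎ d < r → QSer R J Q ℓ j r ≈ 0#
      QSer-outside ℓ j r (inj₁ J<j) = reflexive (≡.cong (λ b → if b then Q ℓ j r else 0#) (≤ᵇ-false J<j))
      QSer-outside ℓ j r (inj₂ d<r) = if-zero (j ≤ᵇ J) (Q≈0 ℓ j r d<r)

      steps-outside : ∀ ℓ j r → J < j ⊎ d < r → common ℓ j r ≈ 0#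
      steps-outside ℓ j r out =
        trans (*-cong (if-zero ((j ≤ᵇ a) ∧ (r ≤ᵇ n)) (QSer-outside ℓ j r out)) refl) (zeroˡ _)

    F-solves-equation : (∀ ℓ j r → d < r → Q ℓ j r ≈ 0#) → ∀ a n → F a n ≈ RHS R L J m Q F a n
    F-solves-equation Q≈0 a zero = begin
      F a 0                ≈⟨ F-by-steps 0 a ≤-refl ⟩
      Fsteps 0 a 0         ≈⟨ Fsteps-zero a 0 ⟩
      uPow R m a 0         ≈⟨ +-identityʳ _ ⟨
      uPow R m a 0 +R 0#   ∎
    F-solves-equation Q≈0 a (suc n) = begin
      F a (suc n)
        ≈⟨ F-by-steps (suc n) a ≤-refl ⟩
      Σ (suc n) (λ M → Fsteps M a (suc n))
        ≈⟨ Σ-suc n ⟩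
      Fsteps 0 a (suc n) +R Σ n (λ M → Fsteps (suc M) a (suc n))
        ≈⟨ +-cong (Fsteps-zero a (suc n)) (Σ-cong n (λ M → Fsteps-suc-suc M a n)) ⟩
      uPow R m a (suc n) +R Σ n (λ M → ΣSteps (λ ℓ j r → w ℓ j r *R Fsteps M (a + ℓ ∸ j) (n ∸ r)))
        ≈⟨ +-cong refl (Σ-ΣSteps-comm n) ⟩
      uPow R m a (suc n) +R ΣSteps (λ ℓ j r → Σ n (λ M → w ℓ j r *R Fsteps M (a + ℓ ∸ j) (n ∸ r)))
        ≈⟨ +-cong refl (ΣSteps-cong (λ ℓ j r → Σ-*ˡ n (w ℓ j r))) ⟨
      uPow R m a (suc n) +R ΣSteps (λ ℓ j r → w ℓ j r *R Σ n (λ M → Fsteps M (a + ℓ ∸ j) (n ∸ r)))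
        ≈⟨ +-cong refl (ΣSteps-cong (λ ℓ j r → *-cong refl (F-by-steps n _ (m∸n≤m n r)))) ⟨
      uPow R m a (suc n) +R ΣSteps (λ ℓ j r → w ℓ j r *R F (a + ℓ ∸ j) (n ∸ r))
        ≈⟨ +-cong refl (convolution-as-steps Q≈0 F a n) ⟨
      RHS R L J m Q F a (suc n) ∎
      where
      w : ℕ → ℕ → ℕ → Carrier
      w = stepWeight Q a n

lemma4 : {c ℓr : Level} (R : CommutativeSemiring c ℓr) →
    let open CommutativeSemiring R in
    (L J m d : ℕ) → 1 ≤ L →
    (Q : ℕ → ℕ → ℕ → Carrier) →
    (∀ ℓ j r → d < r → Q ℓ j r ≈ 0#) →
    (G : ℕ → ℕ → Carrier) →
    (∀ k n → G k n ≈ RHS R L J m Q G k n) →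
    ∀ k n → G k n ≈ Fcoef R L J d Q k m n
lemma4 R L J m d _ Q Q≈0 G G≈RHS =
  fixpoint-unique R (RHS-contractive R L J m Q) G≈RHS (F-solves-equation R L J m d Q Q≈0)
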